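{- Let $G=(V_1\cup V_2,E)$ be a bipartite graph with parts $V_1,V_2$, $|V_1|=|V_2|=n$, and for $i\in\{1,2\}$ let $V_i^{\mathrm{even}}$ be the set of even-degree vertices of $V_i$. Construct $\tilde G$ as follows: add new vertices $\tilde v_{1,1},\tilde v_{1,2}$ to $V_1$ and $\tilde v_{2,1},\tilde v_{2,2}$ to $V_2$; for each $i\in\{1,2\}$, add an edge between every vertex of $V_i^{\mathrm{even}}$ and $\tilde v_{3-i,1}$, and add the edge $\{\tilde v_{3-i,1},\tilde v_{i,2}\}$; finally, if the degrees of $\tilde v_{1,1}$ and $\tilde v_{2,1}$ in the graph so far are even, add the edge $\{\tilde v_{1,1},\tilde v_{2,1}\}$. Then $\tilde G$ is a bipartite graph (with parts $V_1\cup\{\tilde v_{1,1},\tilde v_{1,2}\}$ and $V_2\cup\{\tilde v_{2,1},\tilde v_{2,2}\}$) in which every vertex has odd degree, and $\tilde G$ has the same number of perfect matchings as $G$.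
   Context: A perfect matching is a set of edges covering every vertex exactly once. (The degrees of $\tilde v_{1,1}$ and $\tilde v_{2,1}$ before the last step are $|V_2^{\mathrm{even}}|+1$ and $|V_1^{\mathrm{even}}|+1$, which have the same parity.) -}

module Defs where

open import Data.Bool using (Bool; true; false; _∧_; _∨_; if_then_else_)
open import Data.Nat using (ℕ; zero; suc; _+_; _%_; _≡ᵇ_)
open import Data.Fin using (Fin; zero; suc)
open import Data.Vec.Functional using (_∷_)

countF : (k : ℕ) → (Fin k → Bool) → ℕ
countF zero    f = 0
countF (suc k) f = (if f zero then 1 else 0) + countF k (λ i → f (suc i))

allF : (k : ℕ) → (Fin k → Bool) → Bool
allF zero    f = true
allF (suc k) f = f zero ∧ allF k (λ i → f (suc i))

evenᵇ : ℕ → Bool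
evenᵇ d = d % 2 ≡ᵇ 0

-- A bipartite (simple) graph with parts V₁ = Fin n and V₂ = Fin m,
-- given by its biadjacency relation: A i j = true iff {i , j} ∈ E.
BipGraph : ℕ → ℕ → Set
BipGraph n m = Fin n → Fin m → Bool

deg₁ : ∀ {n m} → BipGraph n m → Fin n → ℕ
deg₁ {n} {m} A i = countF m (λ j → A i j)

deg₂ : ∀ {n m} → BipGraph n m → Fin m → ℕ
deg₂ {n} {m} A j = countF n (λ i → A i j)

isPerfectMatching : ∀ {n m} → BipGraph n m → BipGraph n m → Bool
isPerfectMatching {n} {m} A M =
  allF n (λ i → allF m (λ j → if M i j then A i j else true))
  ∧ allF n (λ i → deg₁ M i ≡ᵇ 1)
  ∧ allF m (λ j → deg₂ M j ≡ᵇ 1)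

sumFun : (k : ℕ) → ((Fin k → Bool) → ℕ) → ℕ
sumFun zero    f = f (λ ())
sumFun (suc k) f = sumFun k (λ g → f (true ∷ g)) + sumFun k (λ g → f (false ∷ g))

sumMat : (r c : ℕ) → ((Fin r → Fin c → Bool) → ℕ) → ℕ
sumMat zero    c f = f (λ ())
sumMat (suc r) c f = sumFun c (λ row → sumMat r c (λ M → f (row ∷ M)))

numPerfectMatchings : ∀ {n m} → BipGraph n m → ℕ
numPerfectMatchings {n} {m} A =
  sumMat n m (λ M → if isPerfectMatching A M then 1 else 0)

-- Parts of G̃ are Fin (2 + n) on both sides:
--   on side i:  zero = ṽ_{i,1},  suc zero = ṽ_{i,2},  suc (suc k) = old vertex k ∈ V_i.
-- G̃₀ is the graph before the last step.
G̃₀ : ∀ {n} → BipGraph n n → BipGraph (suc (suc n)) (suc (suc n))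
G̃₀ A (suc (suc i)) (suc (suc j)) = A i j
G̃₀ A (suc (suc i)) zero          = evenᵇ (deg₁ A i)
G̃₀ A (suc (suc i)) (suc zero)    = false
G̃₀ A zero          (suc (suc j)) = evenᵇ (deg₂ A j)
G̃₀ A (suc zero)    (suc (suc j)) = false
G̃₀ A zero          (suc zero)    = true
G̃₀ A (suc zero)    zero          = true
G̃₀ A zero          zero          = false
G̃₀ A (suc zero)    (suc zero)    = false

isTop : ∀ {n} → Fin (suc (suc n)) → Fin (suc (suc n)) → Bool
isTop zero zero = true
isTop _    _    = false

G̃ : ∀ {n} → BipGraph n n → BipGraph (suc (suc n)) (suc (suc n))
G̃ A i j =
  G̃₀ A i j ∨ (isTop i j ∧ (evenᵇ (deg₁ (G̃₀ A) zero) ∧ evenᵇ (deg₂ (G̃₀ A) zero)))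

-- Parity: each vertex of V_i gains an edge exactly when its degree is even, so old vertices
-- become odd; ṽ_{1,2} and ṽ_{2,2} are leaves.  By the handshake lemma |V₁ᵉᵛᵉⁿ| ≡ |V₂ᵉᵛᵉⁿ|
-- (mod 2), so ṽ_{1,1} and ṽ_{2,1} have degrees of equal parity before the last step, and the
-- optional top edge makes both odd.
-- Matchings: the leaves ṽ_{1,2} and ṽ_{2,2} force the edges {ṽ_{2,1}, ṽ_{1,2}} and
-- {ṽ_{1,1}, ṽ_{2,2}} into every perfect matching of G̃, which then uses no other edge at the
-- new vertices; deleting these two edges is a bijection onto the perfect matchings of G.
module Submission where

open import Defs
open import Data.Bool.Base using (Bool; true; false; not; _∧_; _∨_; if_then_else_)
open import Data.Bool.Properties using (∧-conicalˡ; ∧-conicalʳ; ∧-idem; ∨-identityʳ; not-¬; ¬-not; T-≡)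
open import Data.Empty using (⊥-elim)
open import Data.Fin.Base using (Fin; zero; suc)
open import Data.Fin.Properties using (_≟_)
open import Data.Nat.Base using (ℕ; zero; suc; _+_; _%_; _≡ᵇ_; parity)
open import Data.Nat.Properties using (suc-injective; +-identityʳ; ≡ᵇ⇒≡; +-0-commutativeMonoid)
open import Data.Parity.Base as ℙ using (1ℙ; _⁻¹)
import Data.Parity.Properties as ℙ
open import Data.Product using (_×_; _,_)
open import Function.Bundles using (Equivalence)
open import Data.Vec.Functional using (_∷_)
open import Algebra.Properties.CommutativeMonoid.Sum +-0-commutativeMonoid
  using (sum-syntax; sum-cong-≗; ∑-comm; ∑-distrib-+)
open import Relation.Binary.Core using (_Preserves_⟶_)
open import Relation.Binary.PropositionalEquality
open import Relation.Nullary using (¬_; yes; no)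

χ : Bool → ℕ
χ b = if b then 1 else 0

_≗₂_ : ∀ {r c} → BipGraph r c → BipGraph r c → Set
M ≗₂ M′ = ∀ i → M i ≗ M′ i

allF⇒ : ∀ k (f : Fin k → Bool) → allF k f ≡ true → ∀ i → f i ≡ true
allF⇒ (suc k) f e zero    = ∧-conicalˡ _ _ e
allF⇒ (suc k) f e (suc i) = allF⇒ k (λ i → f (suc i)) (∧-conicalʳ _ _ e) i

allF-cong : ∀ k {f g : Fin k → Bool} → f ≗ g → allF k f ≡ allF k g
allF-cong zero    e = refl
allF-cong (suc k) e = cong₂ _∧_ (e zero) (allF-cong k (λ i → e (suc i)))

allF-true : ∀ k → allF k (λ _ → true) ≡ true
allF-true zero    = refl
allF-true (suc k) = allF-true k

countF-cong : ∀ k {f g : Fin k → Bool} → f ≗ g → countF k f ≡ countF k g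
countF-cong zero    e = refl
countF-cong (suc k) e = cong₂ _+_ (cong χ (e zero)) (countF-cong k (λ i → e (suc i)))

countF-false : ∀ k → countF k (λ _ → false) ≡ 0
countF-false zero    = refl
countF-false (suc k) = countF-false k

countF≡0⇒false : ∀ k (f : Fin k → Bool) → countF k f ≡ 0 → ∀ i → f i ≡ false
countF≡0⇒false (suc k) f c i with f zero in eq
countF≡0⇒false (suc k) f c zero    | false = eq
countF≡0⇒false (suc k) f c (suc i) | false = countF≡0⇒false k (λ i → f (suc i)) c i

countF≡1-unique : ∀ k (f : Fin k → Bool) {i j} →
  countF k f ≡ 1 → f i ≡ true → f j ≡ true → i ≡ j
countF≡1-unique (suc k) f {i} {j} c fi fj with f zero in eq
countF≡1-unique (suc k) f {zero}  {zero}  c fi fj | _     = refl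
countF≡1-unique (suc k) f {suc i} {_}     c fi fj | true  =
  ⊥-elim (not-¬ fi (countF≡0⇒false k (λ i → f (suc i)) (suc-injective c) i))
countF≡1-unique (suc k) f {zero}  {suc j} c fi fj | true  =
  ⊥-elim (not-¬ fj (countF≡0⇒false k (λ i → f (suc i)) (suc-injective c) j))
countF≡1-unique (suc k) f {zero}  {_}     c fi fj | false = ⊥-elim (not-¬ fi eq)
countF≡1-unique (suc k) f {suc i} {zero}  c fi fj | false = ⊥-elim (not-¬ fj eq)
countF≡1-unique (suc k) f {suc i} {suc j} c fi fj | false =
  cong suc (countF≡1-unique k (λ i → f (suc i)) c fi fj)

countF≡1⇒others-false : ∀ k (f : Fin k → Bool) {i j} →
  countF k f ≡ 1 → f i ≡ true → j ≢ i → f j ≡ false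
countF≡1⇒others-false k f c fi j≢i = ¬-not (λ fj → j≢i (countF≡1-unique k f c fj fi))

countF≡1⇒only-true : ∀ k (f : Fin k → Bool) {i} →
  countF k f ≡ 1 → (∀ j → j ≢ i → f j ≡ false) → f i ≡ true
countF≡1⇒only-true k f {i} c others with f i in eq
... | true  = refl
... | false = ⊥-elim (1≢0 (trans (sym c) (trans (countF-cong k all-false) (countF-false k))))
  where
    1≢0 : ¬ (1 ≡ 0)
    1≢0 ()
    all-false : f ≗ (λ _ → false)
    all-false j with j ≟ i
    ... | yes refl = eq
    ... | no j≢i   = others j j≢i

module _ {n m} (A : BipGraph n m) (M : BipGraph n m) (pm : isPerfectMatching A M ≡ true) where

  private
    edgesInA      = allF n (λ i → allF m (λ j → if M i j then A i j else true))
    rowDegrees    = allF n (λ i → deg₁ M i ≡ᵇ 1)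
    columnDegrees = allF m (λ j → deg₂ M j ≡ᵇ 1)

  perfectMatching-⊆ : ∀ i j → A i j ≡ false → M i j ≡ false
  perfectMatching-⊆ i j nonEdge = outside (M i j) (allF⇒ m _ (allF⇒ n _ (∧-conicalˡ edgesInA _ pm) i) j)
    where
      outside : ∀ b → (if b then A i j else true) ≡ true → b ≡ false
      outside false _      = refl
      outside true  inside with () ← trans (sym nonEdge) inside

  perfectMatching-deg₁ : ∀ i → deg₁ M i ≡ 1
  perfectMatching-deg₁ i =
    ≡ᵇ⇒≡ _ 1 (Equivalence.from T-≡
      (allF⇒ n _ (∧-conicalˡ rowDegrees columnDegrees (∧-conicalʳ edgesInA _ pm)) i))

  perfectMatching-deg₂ : ∀ j → deg₂ M j ≡ 1
  perfectMatching-deg₂ j =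
    ≡ᵇ⇒≡ _ 1 (Equivalence.from T-≡
      (allF⇒ m _ (∧-conicalʳ rowDegrees columnDegrees (∧-conicalʳ edgesInA _ pm)) j))

isPerfectMatching-cong : ∀ {n m} (A : BipGraph n m) →
  isPerfectMatching A Preserves _≗₂_ ⟶ _≡_
isPerfectMatching-cong {n} {m} A {M} {M′} e =
  cong₂ _∧_ (allF-cong n (λ i → allF-cong m (λ j → cong (λ b → if b then A i j else true) (e i j))))
    (cong₂ _∧_ (allF-cong n (λ i → cong (_≡ᵇ 1) (countF-cong m (e i))))
               (allF-cong m (λ j → cong (_≡ᵇ 1) (countF-cong n (λ i → e i j)))))

sumFun-cong : ∀ k {f g : (Fin k → Bool) → ℕ} → (∀ x → f x ≡ g x) → sumFun k f ≡ sumFun k g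
sumFun-cong zero    e = e _
sumFun-cong (suc k) e = cong₂ _+_ (sumFun-cong k (λ _ → e _)) (sumFun-cong k (λ _ → e _))

sumMat-cong : ∀ r c {f g : BipGraph r c → ℕ} → (∀ M → f M ≡ g M) → sumMat r c f ≡ sumMat r c g
sumMat-cong zero    c e = e _
sumMat-cong (suc r) c e = sumFun-cong c (λ _ → sumMat-cong r c (λ _ → e _))

sumFun-zero : ∀ k {f : (Fin k → Bool) → ℕ} → (∀ x → f x ≡ 0) → sumFun k f ≡ 0
sumFun-zero zero    e = e _
sumFun-zero (suc k) e = cong₂ _+_ (sumFun-zero k (λ _ → e _)) (sumFun-zero k (λ _ → e _))

sumMat-zero : ∀ r c {f : BipGraph r c → ℕ} → (∀ M → f M ≡ 0) → sumMat r c f ≡ 0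
sumMat-zero zero    c e = e _
sumMat-zero (suc r) c e = sumFun-zero c (λ _ → sumMat-zero r c (λ _ → e _))

sumFun-fixHead : ∀ k b (h : (Fin (suc k) → Bool) → ℕ) →
  (∀ g → h (not b ∷ g) ≡ 0) → sumFun (suc k) h ≡ sumFun k (λ g → h (b ∷ g))
sumFun-fixHead k true  h off =
  trans (cong (sumFun k (λ g → h (true ∷ g)) +_) (sumFun-zero k off)) (+-identityʳ _)
sumFun-fixHead k false h off = cong (_+ sumFun k (λ g → h (false ∷ g))) (sumFun-zero k off)

sumFun-point : ∀ k (h : (Fin k → Bool) → ℕ) (v : Fin k → Bool) → h Preserves _≗_ ⟶ _≡_ →
  (∀ g i → g i ≡ not (v i) → h g ≡ 0) → sumFun k h ≡ h v
sumFun-point zero    h v h-cong off = h-cong (λ ())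
sumFun-point (suc k) h v h-cong off = begin
  sumFun (suc k) h                                  ≡⟨ sumFun-fixHead k (v zero) h (λ g → off _ zero refl) ⟩
  sumFun k (λ g → h (v zero ∷ g))                   ≡⟨ sumFun-point k _ (λ i → v (suc i))
                                                         (λ e → h-cong (λ { zero → refl ; (suc i) → e i }))
                                                         (λ g i → off _ (suc i)) ⟩
  h (v zero ∷ (λ i → v (suc i)))                    ≡⟨ h-cong (λ { zero → refl ; (suc i) → refl }) ⟩
  h v                                               ∎
  where open ≡-Reasoning

sumMat-fixRow : ∀ r c (f : BipGraph (suc r) c → ℕ) (v : Fin c → Bool) → f Preserves _≗₂_ ⟶ _≡_ →
  (∀ M j → M zero j ≡ not (v j) → f M ≡ 0) → sumMat (suc r) c f ≡ sumMat r c (λ M → f (v ∷ M))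
sumMat-fixRow r c f v f-cong off =
  sumFun-point c (λ row → sumMat r c (λ M → f (row ∷ M))) v
    (λ e → sumMat-cong r c (λ M → f-cong (λ { zero → e ; (suc i) _ → refl })))
    (λ row j e → sumMat-zero r c (λ M → off _ j e))

sumMat-dropColumn : ∀ r c (f : BipGraph r (suc c) → ℕ) → f Preserves _≗₂_ ⟶ _≡_ →
  (∀ M i → M i zero ≡ true → f M ≡ 0) → sumMat r (suc c) f ≡ sumMat r c (λ M → f (λ i → false ∷ M i))
sumMat-dropColumn zero    c f f-cong off = f-cong (λ ())
sumMat-dropColumn (suc r) c f f-cong off = begin
  sumMat (suc r) (suc c) f
    ≡⟨ sumFun-fixHead c false (λ row → sumMat r (suc c) (λ M → f (row ∷ M)))
         (λ g → sumMat-zero r (suc c) (λ M → off ((true ∷ g) ∷ M) zero refl)) ⟩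
  sumFun c (λ g → sumMat r (suc c) (λ M → f ((false ∷ g) ∷ M)))
    ≡⟨ sumFun-cong c (λ g → sumMat-dropColumn r c _
         (λ e → f-cong (λ { zero _ → refl ; (suc i) → e i })) (λ M i → off _ (suc i))) ⟩
  sumFun c (λ g → sumMat r c (λ M → f ((false ∷ g) ∷ (λ i → false ∷ M i))))
    ≡⟨ sumFun-cong c (λ g → sumMat-cong r c (λ M → f-cong (λ { zero _ → refl ; (suc i) _ → refl }))) ⟩
  sumMat (suc r) c (λ M → f (λ i → false ∷ M i))
    ∎
  where open ≡-Reasoning

-- `suc (suc a) % 2` reduces to `a % 2`, so the next two lemmas are plain recursions.

parity⇒%2 : ∀ a b → parity a ≡ parity b → a % 2 ≡ b % 2
parity⇒%2 (suc (suc a)) b             e  = parity⇒%2 a b e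
parity⇒%2 a             (suc (suc b)) e  = parity⇒%2 a b e
parity⇒%2 0             0             _  = refl
parity⇒%2 1             1             _  = refl
parity⇒%2 0             1             ()
parity⇒%2 1             0             ()

evenᵇ-cong : ∀ a b → parity a ≡ parity b → evenᵇ a ≡ evenᵇ b
evenᵇ-cong a b e = cong (_≡ᵇ 0) (parity⇒%2 a b e)

parity-suc : ∀ a → parity (suc a) ≡ parity a ⁻¹
parity-suc a = ℙ.+-homo-+ 1 a

parity-χ-evenᵇ : ∀ d → parity (χ (evenᵇ d)) ≡ parity d ⁻¹
parity-χ-evenᵇ 0             = refl
parity-χ-evenᵇ 1             = refl
parity-χ-evenᵇ (suc (suc d)) = parity-χ-evenᵇ d

parity-χ-evenᵇ+ : ∀ d → parity (χ (evenᵇ d) + d) ≡ 1ℙ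
parity-χ-evenᵇ+ d = begin
  parity (χ (evenᵇ d) + d)              ≡⟨ ℙ.+-homo-+ (χ (evenᵇ d)) d ⟩
  parity (χ (evenᵇ d)) ℙ.+ parity d     ≡⟨ cong (ℙ._+ parity d) (parity-χ-evenᵇ d) ⟩
  parity d ⁻¹ ℙ.+ parity d              ≡⟨ ℙ.p⁻¹+p≡1ℙ (parity d) ⟩
  1ℙ                                    ∎
  where open ≡-Reasoning

parity-∑-odd : ∀ k (g : Fin k → ℕ) → (∀ i → parity (g i) ≡ 1ℙ) → parity (∑[ i < k ] g i) ≡ parity k
parity-∑-odd zero    g odd = refl
parity-∑-odd (suc k) g odd = begin
  parity (g zero + ∑[ i < k ] g (suc i))            ≡⟨ ℙ.+-homo-+ (g zero) _ ⟩
  parity (g zero) ℙ.+ parity (∑[ i < k ] g (suc i)) ≡⟨ cong₂ ℙ._+_ (odd zero) (parity-∑-odd k _ (λ i → odd (suc i))) ⟩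
  parity k ⁻¹                                       ≡⟨ parity-suc k ⟨
  parity (suc k)                                    ∎
  where open ≡-Reasoning

countF≡∑χ : ∀ k (f : Fin k → Bool) → countF k f ≡ ∑[ i < k ] χ (f i)
countF≡∑χ zero    f = refl
countF≡∑χ (suc k) f = cong (χ (f zero) +_) (countF≡∑χ k (λ i → f (suc i)))

handshake : ∀ {n m} (A : BipGraph n m) → ∑[ i < n ] deg₁ A i ≡ ∑[ j < m ] deg₂ A j
handshake {n} {m} A = begin
  ∑[ i < n ] deg₁ A i               ≡⟨ sum-cong-≗ (λ i → countF≡∑χ m (A i)) ⟩
  ∑[ i < n ] ∑[ j < m ] χ (A i j)   ≡⟨ ∑-comm (λ i j → χ (A i j)) ⟩
  ∑[ j < m ] ∑[ i < n ] χ (A i j)   ≡⟨ sum-cong-≗ (λ j → countF≡∑χ n (λ i → A i j)) ⟨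
  ∑[ j < m ] deg₂ A j               ∎
  where open ≡-Reasoning

parity-#evenᵇ+∑ : ∀ k (d : Fin k → ℕ) →
  parity (countF k (λ i → evenᵇ (d i)) + ∑[ i < k ] d i) ≡ parity k
parity-#evenᵇ+∑ k d = begin
  parity (countF k (λ i → evenᵇ (d i)) + ∑[ i < k ] d i)
    ≡⟨ cong (λ c → parity (c + ∑[ i < k ] d i)) (countF≡∑χ k _) ⟩
  parity (∑[ i < k ] χ (evenᵇ (d i)) + ∑[ i < k ] d i)
    ≡⟨ cong parity (∑-distrib-+ (λ i → χ (evenᵇ (d i))) d) ⟨
  parity (∑[ i < k ] (χ (evenᵇ (d i)) + d i))
    ≡⟨ parity-∑-odd k _ (λ i → parity-χ-evenᵇ+ (d i)) ⟩
  parity k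
    ∎
  where open ≡-Reasoning

#even₁ #even₂ : ∀ {n m} → BipGraph n m → ℕ
#even₁ {n} A = countF n (λ i → evenᵇ (deg₁ A i))
#even₂ {m = m} A = countF m (λ j → evenᵇ (deg₂ A j))

parity-#even₁≡#even₂ : ∀ {n} (A : BipGraph n n) → parity (#even₁ A) ≡ parity (#even₂ A)
parity-#even₁≡#even₂ {n} A = ℙ.+-cancelʳ-≡ (parity S) _ _ (begin
  parity (#even₁ A) ℙ.+ parity S              ≡⟨ ℙ.+-homo-+ (#even₁ A) S ⟨
  parity (#even₁ A + S)                       ≡⟨ parity-#evenᵇ+∑ n (deg₁ A) ⟩
  parity n                                    ≡⟨ parity-#evenᵇ+∑ n (deg₂ A) ⟨
  parity (#even₂ A + ∑[ j < n ] deg₂ A j)     ≡⟨ cong (λ s → parity (#even₂ A + s)) (handshake A) ⟨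
  parity (#even₂ A + S)                       ≡⟨ ℙ.+-homo-+ (#even₂ A) S ⟩
  parity (#even₂ A) ℙ.+ parity S              ∎)
  where
    open ≡-Reasoning
    S = ∑[ i < n ] deg₁ A i

module _ {n} (A : BipGraph n n) where

  deg-ṽ₁₁ deg-ṽ₂₁ : ℕ
  deg-ṽ₁₁ = deg₁ (G̃₀ A) zero
  deg-ṽ₂₁ = deg₂ (G̃₀ A) zero

  topEdge : Bool
  topEdge = evenᵇ deg-ṽ₁₁ ∧ evenᵇ deg-ṽ₂₁

  G̃-sucʳ : ∀ i j → G̃ A i (suc j) ≡ G̃₀ A i (suc j)
  G̃-sucʳ zero    j = ∨-identityʳ _
  G̃-sucʳ (suc i) j = ∨-identityʳ _

  deg₁-G̃-zero : deg₁ (G̃ A) zero ≡ χ topEdge + deg-ṽ₁₁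
  deg₁-G̃-zero = cong (χ topEdge +_) (countF-cong (suc n) (λ j → G̃-sucʳ zero j))

  deg₂-G̃-zero : deg₂ (G̃ A) zero ≡ χ topEdge + deg-ṽ₂₁
  deg₂-G̃-zero = cong (χ topEdge +_) (countF-cong (suc n) (λ i → ∨-identityʳ (G̃₀ A (suc i) zero)))

  deg₁-G̃-suc : ∀ i → deg₁ (G̃ A) (suc i) ≡ deg₁ (G̃₀ A) (suc i)
  deg₁-G̃-suc i = countF-cong (suc (suc n)) (λ j → ∨-identityʳ (G̃₀ A (suc i) j))

  deg₂-G̃-suc : ∀ j → deg₂ (G̃ A) (suc j) ≡ deg₂ (G̃₀ A) (suc j)
  deg₂-G̃-suc j = countF-cong (suc (suc n)) (λ i → G̃-sucʳ i j)

  -- The degrees of ṽ_{1,1} and ṽ_{2,1} in G̃₀ are 1 + |V₂ᵉᵛᵉⁿ| and 1 + |V₁ᵉᵛᵉⁿ|.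
  parity-deg-ṽ₁₁≡deg-ṽ₂₁ : parity deg-ṽ₁₁ ≡ parity deg-ṽ₂₁
  parity-deg-ṽ₁₁≡deg-ṽ₂₁ = begin
    parity (suc (#even₂ A))  ≡⟨ parity-suc (#even₂ A) ⟩
    parity (#even₂ A) ⁻¹     ≡⟨ cong _⁻¹ (parity-#even₁≡#even₂ A) ⟨
    parity (#even₁ A) ⁻¹     ≡⟨ parity-suc (#even₁ A) ⟨
    parity (suc (#even₁ A))  ∎
    where open ≡-Reasoning

  topEdge≡evenᵇ-deg-ṽ₁₁ : topEdge ≡ evenᵇ deg-ṽ₁₁
  topEdge≡evenᵇ-deg-ṽ₁₁ =
    trans (cong (evenᵇ deg-ṽ₁₁ ∧_) (evenᵇ-cong deg-ṽ₂₁ deg-ṽ₁₁ (sym parity-deg-ṽ₁₁≡deg-ṽ₂₁)))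
          (∧-idem _)

  topEdge≡evenᵇ-deg-ṽ₂₁ : topEdge ≡ evenᵇ deg-ṽ₂₁
  topEdge≡evenᵇ-deg-ṽ₂₁ =
    trans (cong (_∧ evenᵇ deg-ṽ₂₁) (evenᵇ-cong deg-ṽ₁₁ deg-ṽ₂₁ parity-deg-ṽ₁₁≡deg-ṽ₂₁))
          (∧-idem _)

  parity-deg₁-G̃ : ∀ i → parity (deg₁ (G̃ A) i) ≡ 1ℙ
  parity-deg₁-G̃ zero =
    trans (cong parity (trans deg₁-G̃-zero (cong (λ b → χ b + deg-ṽ₁₁) topEdge≡evenᵇ-deg-ṽ₁₁)))
          (parity-χ-evenᵇ+ deg-ṽ₁₁)
  parity-deg₁-G̃ (suc zero)    = cong parity (trans (deg₁-G̃-suc zero) (cong suc (countF-false n)))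
  parity-deg₁-G̃ (suc (suc i)) = trans (cong parity (deg₁-G̃-suc (suc i))) (parity-χ-evenᵇ+ (deg₁ A i))

  parity-deg₂-G̃ : ∀ j → parity (deg₂ (G̃ A) j) ≡ 1ℙ
  parity-deg₂-G̃ zero =
    trans (cong parity (trans deg₂-G̃-zero (cong (λ b → χ b + deg-ṽ₂₁) topEdge≡evenᵇ-deg-ṽ₂₁)))
          (parity-χ-evenᵇ+ deg-ṽ₂₁)
  parity-deg₂-G̃ (suc zero)    = cong parity (trans (deg₂-G̃-suc zero) (cong suc (countF-false n)))
  parity-deg₂-G̃ (suc (suc j)) = trans (cong parity (deg₂-G̃-suc (suc j))) (parity-χ-evenᵇ+ (deg₂ A j))

toṽ₂₁ toṽ₂₂ : ∀ {n} → Fin (suc (suc n)) → Bool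
toṽ₂₁ = true ∷ false ∷ λ _ → false
toṽ₂₂ = false ∷ true ∷ λ _ → false

embed : ∀ {n} → BipGraph n n → BipGraph (suc (suc n)) (suc (suc n))
embed R = toṽ₂₂ ∷ toṽ₂₁ ∷ λ i → false ∷ false ∷ R i

module _ {n} (A : BipGraph n n) where

  private
    N : ℕ
    N = suc (suc n)

  ṽ₁₂-leaf : ∀ j → j ≢ zero → G̃ A (suc zero) j ≡ false
  ṽ₁₂-leaf zero          j≢0 = ⊥-elim (j≢0 refl)
  ṽ₁₂-leaf (suc zero)    _   = refl
  ṽ₁₂-leaf (suc (suc j)) _   = refl

  ṽ₂₂-leaf : ∀ i → i ≢ zero → G̃ A i (suc zero) ≡ false
  ṽ₂₂-leaf zero          i≢0 = ⊥-elim (i≢0 refl)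
  ṽ₂₂-leaf (suc zero)    _   = refl
  ṽ₂₂-leaf (suc (suc i)) _   = refl

  module ForcedEdges (M : BipGraph N N) (pm : isPerfectMatching (G̃ A) M ≡ true) where

    private
      ⊆       = perfectMatching-⊆ (G̃ A) M pm
      degree₁ = perfectMatching-deg₁ (G̃ A) M pm
      degree₂ = perfectMatching-deg₂ (G̃ A) M pm

    ṽ₁₂ṽ₂₁ : M (suc zero) zero ≡ true
    ṽ₁₂ṽ₂₁ = countF≡1⇒only-true N (M (suc zero)) (degree₁ (suc zero))
               (λ j j≢0 → ⊆ (suc zero) j (ṽ₁₂-leaf j j≢0))

    ṽ₁₁ṽ₂₂ : M zero (suc zero) ≡ true
    ṽ₁₁ṽ₂₂ = countF≡1⇒only-true N (λ i → M i (suc zero)) (degree₂ (suc zero))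
               (λ i i≢0 → ⊆ i (suc zero) (ṽ₂₂-leaf i i≢0))

    row-ṽ₁₁ : ∀ j → M zero j ≡ toṽ₂₂ j
    row-ṽ₁₁ zero          = countF≡1⇒others-false N (M zero) (degree₁ zero) ṽ₁₁ṽ₂₂ (λ ())
    row-ṽ₁₁ (suc zero)    = ṽ₁₁ṽ₂₂
    row-ṽ₁₁ (suc (suc j)) = countF≡1⇒others-false N (M zero) (degree₁ zero) ṽ₁₁ṽ₂₂ (λ ())

    row-ṽ₁₂ : ∀ j → M (suc zero) j ≡ toṽ₂₁ j
    row-ṽ₁₂ zero          = ṽ₁₂ṽ₂₁
    row-ṽ₁₂ (suc zero)    = ⊆ (suc zero) (suc zero) refl
    row-ṽ₁₂ (suc (suc j)) = ⊆ (suc zero) (suc (suc j)) refl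

    column-ṽ₂₁ : ∀ i → M (suc (suc i)) zero ≡ false
    column-ṽ₂₁ i = countF≡1⇒others-false N (λ i → M i zero) (degree₂ zero) ṽ₁₂ṽ₂₁ (λ ())

    column-ṽ₂₂ : ∀ i → M (suc (suc i)) (suc zero) ≡ false
    column-ṽ₂₂ i = ⊆ (suc (suc i)) (suc zero) refl

  isPerfectMatching-embed : ∀ R → isPerfectMatching (G̃ A) (embed R) ≡ isPerfectMatching A R
  isPerfectMatching-embed R = cong₂ _∧_ edges (cong₂ _∧_ (cong₂ _∧_ degreeOne (cong₂ _∧_ degreeOne refl))
                                                          (cong₂ _∧_ degreeOne (cong₂ _∧_ degreeOne refl)))
    where
      degreeOne : (suc (countF n (λ _ → false)) ≡ᵇ 1) ≡ true
      degreeOne = cong (λ c → suc c ≡ᵇ 1) (countF-false n)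
      edges : allF N (λ i → allF N (λ j → if embed R i j then G̃ A i j else true))
            ≡ allF n (λ i → allF n (λ j → if R i j then A i j else true))
      edges rewrite allF-true n =
        allF-cong n (λ i → allF-cong n (λ j → cong (λ b → if R i j then b else true) (∨-identityʳ (A i j))))

  numPerfectMatchings-G̃ : numPerfectMatchings (G̃ A) ≡ numPerfectMatchings A
  numPerfectMatchings-G̃ = begin
    sumMat N N F
      ≡⟨ sumMat-fixRow (suc n) N F toṽ₂₂ F-cong
           (λ M j → vanishes-unless M zero j (λ pm → ForcedEdges.row-ṽ₁₁ M pm j)) ⟩
    sumMat (suc n) N (λ M → F (toṽ₂₂ ∷ M))
      ≡⟨ sumMat-fixRow n N _ toṽ₂₁ (λ e → F-cong (∷-cong toṽ₂₂ e))
           (λ M j → let M′ = toṽ₂₂ ∷ M in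
                      vanishes-unless M′ (suc zero) j (λ pm → ForcedEdges.row-ṽ₁₂ M′ pm j)) ⟩
    sumMat n N (λ M → F (toṽ₂₂ ∷ toṽ₂₁ ∷ M))
      ≡⟨ sumMat-dropColumn n (suc n) _ (λ e → F-cong (∷-cong toṽ₂₂ (∷-cong toṽ₂₁ e)))
           (λ M i → let M′ = toṽ₂₂ ∷ toṽ₂₁ ∷ M in
                      vanishes-unless M′ (suc (suc i)) zero (λ pm → ForcedEdges.column-ṽ₂₁ M′ pm i)) ⟩
    sumMat n (suc n) (λ M → F (toṽ₂₂ ∷ toṽ₂₁ ∷ λ i → false ∷ M i))
      ≡⟨ sumMat-dropColumn n n _ (λ e → F-cong (∷-cong toṽ₂₂ (∷-cong toṽ₂₁ (false∷-cong e))))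
           (λ M i → let M′ = toṽ₂₂ ∷ toṽ₂₁ ∷ λ i → false ∷ M i in
                      vanishes-unless M′ (suc (suc i)) (suc zero) (λ pm → ForcedEdges.column-ṽ₂₂ M′ pm i)) ⟩
    sumMat n n (λ R → F (embed R))
      ≡⟨ sumMat-cong n n (λ R → cong χ (isPerfectMatching-embed R)) ⟩
    numPerfectMatchings A
      ∎
    where
      open ≡-Reasoning
      F : BipGraph N N → ℕ
      F M = χ (isPerfectMatching (G̃ A) M)
      F-cong : F Preserves _≗₂_ ⟶ _≡_
      F-cong e = cong χ (isPerfectMatching-cong (G̃ A) e)
      vanishes-unless : ∀ M i j {b} →
        (isPerfectMatching (G̃ A) M ≡ true → M i j ≡ b) → M i j ≡ not b → F M ≡ 0
      vanishes-unless M i j forced e = cong χ (¬-not (λ pm → not-¬ (forced pm) e))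
      ∷-cong : ∀ {r c} (v : Fin c → Bool) {M M′ : BipGraph r c} → M ≗₂ M′ → (v ∷ M) ≗₂ (v ∷ M′)
      ∷-cong v e zero    _ = refl
      ∷-cong v e (suc i) j = e i j
      false∷-cong : ∀ {r c} {M M′ : BipGraph r c} →
        M ≗₂ M′ → (λ i → false ∷ M i) ≗₂ (λ i → false ∷ M′ i)
      false∷-cong e i zero    = refl
      false∷-cong e i (suc j) = e i j

lemma3 : (n : ℕ) (A : BipGraph n n) →
    ((i : _) → deg₁ (G̃ A) i % 2 ≡ 1)
    × ((j : _) → deg₂ (G̃ A) j % 2 ≡ 1)
    × numPerfectMatchings (G̃ A) ≡ numPerfectMatchings A
lemma3 n A =
  (λ i → parity⇒%2 (deg₁ (G̃ A) i) 1 (parity-deg₁-G̃ A i)) ,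
  (λ j → parity⇒%2 (deg₂ (G̃ A) j) 1 (parity-deg₂-G̃ A j)) ,
  numPerfectMatchings-G̃ A
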